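{- Let $n\ge 4$ and fix $m$ with $3\le m\le n-1$. Let $DC_n^{(m)}$ be the digraph on vertex set $\{1,2,\ldots,n\}$ whose arcs are $(t,t+1)$ for $1\le t\le n-1$, the arc $(n,1)$, and all arcs $(i,j)$ with $i<j-1$ and $3\le j\le m$. Then $$\Psi_{DC_n^{(m)}}(x)=x^n-(x+1)^{m-2}.$$
   Context: The characteristic polynomial $\Psi_X(x)$ of a digraph $X$ is $\det(xI-A)$, where $A$ is the adjacency matrix of $X$ (the $(i,j)$ entry is the number of arcs from $i$ to $j$). -}

module Defs where

open import Level using (Level)
open import Data.Nat using (ℕ; zero; suc; _∸_; _≟_; _<?_; _≤?_)
open import Data.Fin using (Fin; toℕ; punchIn) renaming (zero to fzero; suc to fsuc)
import Data.Fin as F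
open import Data.Bool using (Bool; true; false; _∨_; _∧_; if_then_else_)
open import Relation.Nullary.Decidable using (⌊_⌋)
open import Algebra.Bundles using (CommutativeRing)

module _ {c ℓ : Level} (R : CommutativeRing c ℓ) where
  open CommutativeRing R

  pow : Carrier → ℕ → Carrier
  pow x zero    = 1#
  pow x (suc k) = x * pow x k

  altSum : ∀ {k} → (Fin k → Carrier) → Carrier
  altSum {zero}  f = 0#
  altSum {suc k} f = f fzero - altSum (λ j → f (fsuc j))

  det : (n : ℕ) → (Fin n → Fin n → Carrier) → Carrier
  det zero    M = 1#
  det (suc n) M = altSum (λ j → M fzero j * det n (λ r c → M (fsuc r) (punchIn j c)))

  count : Bool → Carrier
  count true  = 1#
  count false = 0#

-- Arc predicate of DC_n^(m) on 1-based labels i j ∈ {1..n}: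
--   (t,t+1) for 1 ≤ t ≤ n-1, the arc (n,1), and (i,j) with i < j-1 and 3 ≤ j ≤ m.
arc : (n m i j : ℕ) → Bool
arc n m i j =
  (⌊ j ≟ suc i ⌋ ∧ ⌊ suc i ≤? n ⌋)
  ∨ (⌊ i ≟ n ⌋ ∧ ⌊ j ≟ 1 ⌋)
  ∨ (⌊ suc i <? j ⌋ ∧ ⌊ 3 ≤? j ⌋ ∧ ⌊ j ≤? m ⌋)

module _ {c ℓ : Level} (R : CommutativeRing c ℓ) where
  open CommutativeRing R

  -- Adjacency matrix of DC_n^(m); vertex a : Fin n has label toℕ a + 1.
  adjDC : (n m : ℕ) → Fin n → Fin n → Carrier
  adjDC n m a b = count R (arc n m (suc (toℕ a)) (suc (toℕ b)))

  charMat : (n m : ℕ) → Carrier → Fin n → Fin n → Carrier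
  charMat n m x a b = (if ⌊ a F.≟ b ⌋ then x else 0#) - adjDC n m a b

  charPolyDC : (n m : ℕ) → Carrier → Carrier
  charPolyDC n m x = det R n (charMat n m x)

module Submission where

-- Let M = xI - A with vertices 1..n as rows/columns 0..n-1.  Only vertex n has
-- an arc into vertex 1, so the first column of M is x·e₀ - e_{n-1}.  Expanding
-- along that column (`det-twoEntries`) gives two terms:
--   * x times the minor at (0,0), which is upper triangular with diagonal x
--     (every arc except (n,1) goes forward), contributing x·x^(n-1);
--   * (-1)^(n-1)·(-1) times the minor at (n-1,0).  That minor is a lower
--     Hessenberg matrix H_K(n-1) (K = m-1) with x on the subdiagonal and -1 on
--     the diagonal and at the positions (r,c) with r < c < K.
-- Expanding H_K(s) along its first column (entries -1 and x) gives the
-- recurrence det H_K(s) = -(x+1)·det H_{K-1}(s-1) for K ≥ 2, resp. -det H_0(s-1)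
-- for K ≤ 1, so det H_K(s) = (-1)^s (x+1)^(K-1) (`det-hessenberg`).

open import Defs
open import Level using (Level)
open import Data.Nat using (ℕ; zero; suc; _≤_; _<_; _∸_; z≤n; s≤s; _≡ᵇ_; _<ᵇ_; _≟_; _≤?_; _<?_)
open import Data.Nat.Properties using (<-irrefl; <⇒≤; <⇒≱; ≤-reflexive; ≤-refl; ≤-trans; n≤1+n)
import Data.Nat.Properties as ℕ
open import Data.Bool using (Bool; true; false; _∧_; _∨_; if_then_else_)
open import Data.Bool.Properties using (∨-identityʳ; ∧-identityʳ; ∧-zeroʳ)
open import Data.Empty using (⊥-elim)
open import Data.Fin using (Fin; toℕ; fromℕ; punchIn) renaming (zero to fzero; suc to fsuc)
open import Data.Fin.Properties using (toℕ-injective; toℕ-fromℕ; toℕ<n; suc-injective) renaming (_≟_ to _≟ᶠ_)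
open import Relation.Binary.PropositionalEquality as ≡ using (_≡_; _≢_)
open import Relation.Nullary using (¬_; Dec; yes; no)
open import Relation.Nullary.Decidable using (⌊_⌋; isYes≗does; dec-true; dec-false; ⌊⌋-map′)
open import Algebra.Bundles using (CommutativeRing)

⌊⌋-true : ∀ {a} {A : Set a} (d : Dec A) → A → ⌊ d ⌋ ≡ true
⌊⌋-true d p = ≡.trans (isYes≗does d) (dec-true d p)

⌊⌋-false : ∀ {a} {A : Set a} (d : Dec A) → ¬ A → ⌊ d ⌋ ≡ false
⌊⌋-false d ¬p = ≡.trans (isYes≗does d) (dec-false d ¬p)

⌊≟ᶠ⌋-toℕ : ∀ {k} (u v : Fin k) → ⌊ u ≟ᶠ v ⌋ ≡ (toℕ u ≡ᵇ toℕ v)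
⌊≟ᶠ⌋-toℕ fzero    fzero    = ≡.refl
⌊≟ᶠ⌋-toℕ fzero    (fsuc v) = ≡.refl
⌊≟ᶠ⌋-toℕ (fsuc u) fzero    = ≡.refl
⌊≟ᶠ⌋-toℕ (fsuc u) (fsuc v) = ≡.trans (⌊⌋-map′ _ _ (u ≟ᶠ v)) (⌊≟ᶠ⌋-toℕ u v)

toℕ-punchIn-last : ∀ k (r : Fin k) → toℕ (punchIn (fromℕ k) r) ≡ toℕ r
toℕ-punchIn-last (suc k) fzero    = ≡.refl
toℕ-punchIn-last (suc k) (fsuc r) = ≡.cong suc (toℕ-punchIn-last k r)

arc-backward : ∀ n m a b → b ≤ a → arc n m (suc (suc a)) (suc (suc b)) ≡ false
arc-backward n m a b b≤a with suc (suc b) ≟ suc (suc (suc a)) | suc (suc (suc a)) <? suc (suc b)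
... | no _  | no _ = ≡.trans (∨-identityʳ _) (∧-zeroʳ _)
... | yes e | _    = ⊥-elim (<⇒≱ (≤-reflexive (≡.sym (ℕ.suc-injective (ℕ.suc-injective e)))) b≤a)
... | _     | yes (s≤s (s≤s a+2≤b)) = ⊥-elim (<⇒≱ (≤-trans (n≤1+n _) a+2≤b) b≤a)

arc-into-first : ∀ n m r → arc n m (suc r) 1 ≡ ⌊ suc r ≟ n ⌋
arc-into-first n m r = ≡.trans (∨-identityʳ _) (∧-identityʳ _)

arc-chord : ∀ n K a b → suc a < n →
            arc n (suc K) (suc a) (suc (suc b)) ≡ ((b ≡ᵇ a) ∨ ((a <ᵇ b) ∧ (b <ᵇ K)))
arc-chord n K a b a+1<n with suc (suc a) ≤? n | suc a ≟ n
... | no a+1≮n | _     = ⊥-elim (a+1≮n a+1<n)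
... | _        | yes e = ⊥-elim (<-irrefl e a+1<n)
... | yes _    | no _  = ≡.cong₂ _∨_ (≡.trans (∧-identityʳ _) (isYes≗does (suc (suc b) ≟ suc (suc a)))) (forward b)
  where
  forward : ∀ b → (⌊ suc (suc a) <? suc (suc b) ⌋ ∧ (⌊ 3 ≤? suc (suc b) ⌋ ∧ ⌊ suc (suc b) ≤? suc K ⌋))
                  ≡ ((a <ᵇ b) ∧ (b <ᵇ K))
  forward zero    = ≡.refl
  forward (suc b) = ≡.cong₂ _∧_ (isYes≗does (suc (suc a) <? suc (suc (suc b))))
                              (isYes≗does (suc (suc (suc b)) ≤? suc K))

module _ {c ℓ : Level} (R : CommutativeRing c ℓ) where
  open CommutativeRing R hiding (zero)
  open import Algebra.Properties.Ring ring using (-0#≈0#; -‿involutive; -‿+-comm; -‿distribˡ-*; -‿distribʳ-*; -1*x≈-x; x[y-z]≈xy-xz)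
  open import Algebra.Properties.CommutativeSemigroup +-commutativeSemigroup using (interchange)
  open import Relation.Binary.Reasoning.Setoid setoid

  y-0≈y : ∀ y → y - 0# ≈ y
  y-0≈y y = trans (+-congˡ -0#≈0#) (+-identityʳ y)

  0-y≈-y : ∀ y → 0# - y ≈ - y
  0-y≈-y y = +-identityˡ (- y)

  signed : ℕ → Carrier → Carrier
  signed zero    y = y
  signed (suc k) y = - signed k y

  signed-cong : ∀ k {y z} → y ≈ z → signed k y ≈ signed k z
  signed-cong zero    e = e
  signed-cong (suc k) e = -‿cong (signed-cong k e)

  signed-*ˡ : ∀ k y z → signed k (y * z) ≈ signed k y * z
  signed-*ˡ zero    y z = refl
  signed-*ˡ (suc k) y z = trans (-‿cong (signed-*ˡ k y z)) (-‿distribˡ-* (signed k y) z)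

  signed-*ʳ : ∀ k a y → a * signed k y ≈ signed k (a * y)
  signed-*ʳ zero    a y = refl
  signed-*ʳ (suc k) a y = trans (sym (-‿distribʳ-* a (signed k y))) (-‿cong (signed-*ʳ k a y))

  signed-neg : ∀ k y → signed k (- y) ≈ - signed k y
  signed-neg zero    y = refl
  signed-neg (suc k) y = -‿cong (signed-neg k y)

  signed-involutive : ∀ k y → signed k (signed k y) ≈ y
  signed-involutive zero    y = refl
  signed-involutive (suc k) y = begin
    - signed k (- signed k y) ≈⟨ -‿cong (signed-neg k (signed k y)) ⟩
    - - signed k (signed k y) ≈⟨ -‿involutive _ ⟩
    signed k (signed k y)     ≈⟨ signed-involutive k y ⟩
    y                         ∎

  altSum-cong : ∀ {k} (f g : Fin k → Carrier) → (∀ j → f j ≈ g j) → altSum R f ≈ altSum R g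
  altSum-cong {zero}  f g e = refl
  altSum-cong {suc k} f g e = +-cong (e fzero) (-‿cong (altSum-cong _ _ (λ j → e (fsuc j))))

  altSum-zero : ∀ {k} (f : Fin k → Carrier) → (∀ j → f j ≈ 0#) → altSum R f ≈ 0#
  altSum-zero {zero}  f e = refl
  altSum-zero {suc k} f e = begin
    f fzero - altSum R (λ j → f (fsuc j)) ≈⟨ +-cong (e fzero) (-‿cong (altSum-zero _ (λ j → e (fsuc j)))) ⟩
    0# - 0#                               ≈⟨ y-0≈y 0# ⟩
    0#                                    ∎

  altSum-scale : ∀ {k} a (f : Fin k → Carrier) → altSum R (λ j → a * f j) ≈ a * altSum R f
  altSum-scale {zero}  a f = sym (zeroʳ a)
  altSum-scale {suc k} a f = begin
    a * f fzero - altSum R (λ j → a * f (fsuc j)) ≈⟨ +-congˡ (-‿cong (altSum-scale a (λ j → f (fsuc j)))) ⟩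
    a * f fzero - a * altSum R (λ j → f (fsuc j)) ≈⟨ sym (x[y-z]≈xy-xz a _ _) ⟩
    a * (f fzero - altSum R (λ j → f (fsuc j)))   ∎

  altSum-+ : ∀ {k} (f g : Fin k → Carrier) → altSum R (λ j → f j + g j) ≈ altSum R f + altSum R g
  altSum-+ {zero}  f g = sym (+-identityʳ 0#)
  altSum-+ {suc k} f g = begin
    (f fzero + g fzero) - altSum R (λ j → f (fsuc j) + g (fsuc j))
      ≈⟨ +-congˡ (-‿cong (altSum-+ (λ j → f (fsuc j)) (λ j → g (fsuc j)))) ⟩
    (f fzero + g fzero) + - (F + G) ≈⟨ +-congˡ (sym (-‿+-comm F G)) ⟩
    (f fzero + g fzero) + (- F + - G) ≈⟨ interchange _ _ _ _ ⟩
    (f fzero - F) + (g fzero - G)   ∎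
    where
    F = altSum R (λ j → f (fsuc j))
    G = altSum R (λ j → g (fsuc j))

  Matrix : ℕ → Set c
  Matrix s = Fin s → Fin s → Carrier

  minor : ∀ {s} → Matrix (suc s) → Fin (suc s) → Matrix s
  minor M j r c = M (fsuc r) (punchIn j c)

  det-cong : ∀ s {M N : Matrix s} → (∀ r c → M r c ≈ N r c) → det R s M ≈ det R s N
  det-cong zero    e = refl
  det-cong (suc s) {M} {N} e =
    altSum-cong (λ j → M fzero j * det R s (minor M j)) (λ j → N fzero j * det R s (minor N j))
                (λ j → *-cong (e fzero j) (det-cong s (λ r c → e (fsuc r) (punchIn j c))))

  det-zeroTopRow : ∀ s (M : Matrix (suc s)) → (∀ c → M fzero c ≈ 0#) → det R (suc s) M ≈ 0#
  det-zeroTopRow s M z =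
    altSum-zero (λ j → M fzero j * det R s (minor M j)) (λ j → trans (*-congʳ (z j)) (zeroˡ _))

  det-zeroFirstColumn : ∀ s (M : Matrix (suc s)) → (∀ r → M r fzero ≈ 0#) → det R (suc s) M ≈ 0#
  det-zeroFirstColumn zero M z =
    altSum-zero (λ j → M fzero j * det R zero (minor M j)) λ { fzero → trans (*-congʳ (z fzero)) (zeroˡ _) }
  det-zeroFirstColumn (suc s) M z = altSum-zero (λ j → M fzero j * det R (suc s) (minor M j)) λ
    { fzero    → trans (*-congʳ (z fzero)) (zeroˡ _)
    ; (fsuc j) → trans (*-congˡ (det-zeroFirstColumn s (minor M (fsuc j)) (λ r → z (fsuc r)))) (zeroʳ _) }

  det-topEntry : ∀ s (M : Matrix (suc s)) → (∀ r → M (fsuc r) fzero ≈ 0#) →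
                 det R (suc s) M ≈ M fzero fzero * det R s (minor M fzero)
  det-topEntry zero    M z = y-0≈y _
  det-topEntry (suc s) M z = trans (+-congˡ (-‿cong (altSum-zero (λ j → M fzero (fsuc j) * det R (suc s) (minor M (fsuc j))) λ j →
      trans (*-congˡ (det-zeroFirstColumn s (minor M (fsuc j)) z)) (zeroʳ _)))) (y-0≈y _)

  det-singleEntry : ∀ s (p : Fin (suc s)) (M : Matrix (suc s)) → (∀ r → r ≢ p → M r fzero ≈ 0#) →
                    det R (suc s) M ≈ signed (toℕ p) (M p fzero * det R s (λ r c → M (punchIn p r) (fsuc c)))
  det-singleEntry s       fzero    M z = det-topEntry s M (λ r → z (fsuc r) (λ ()))
  det-singleEntry (suc s) (fsuc p) M z = begin
    M fzero fzero * det R (suc s) (minor M fzero) - altSum R (λ j → f j * det R (suc s) (minor M (fsuc j)))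
      ≈⟨ +-cong (trans (*-congʳ (z fzero (λ ()))) (zeroˡ _))
                (-‿cong (altSum-cong _ (λ j → f j * signed (toℕ p) (a * g j)) λ j → *-congˡ (det-singleEntry s p (minor M (fsuc j))
                                                   (λ r r≢p → z (fsuc r) (λ e → r≢p (suc-injective e)))))) ⟩
    0# - altSum R (λ j → f j * signed (toℕ p) (a * g j))
      ≈⟨ 0-y≈-y _ ⟩
    - altSum R (λ j → f j * signed (toℕ p) (a * g j))
      ≈⟨ -‿cong (altSum-cong _ _ pull-sign) ⟩
    - altSum R (λ j → signed (toℕ p) a * (f j * g j))
      ≈⟨ -‿cong (altSum-scale (signed (toℕ p) a) (λ j → f j * g j)) ⟩
    - (signed (toℕ p) a * altSum R (λ j → f j * g j))
      ≈⟨ -‿cong (sym (signed-*ˡ (toℕ p) a _)) ⟩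
    - signed (toℕ p) (a * altSum R (λ j → f j * g j)) ∎
    where
    a = M (fsuc p) fzero
    f : Fin (suc s) → Carrier
    f j = M fzero (fsuc j)
    g : Fin (suc s) → Carrier
    g j = det R s (λ r c → M (fsuc (punchIn p r)) (fsuc (punchIn j c)))
    pull-sign : ∀ j → f j * signed (toℕ p) (a * g j) ≈ signed (toℕ p) a * (f j * g j)
    pull-sign j = begin
      f j * signed (toℕ p) (a * g j)   ≈⟨ *-congˡ (signed-*ˡ (toℕ p) a (g j)) ⟩
      f j * (signed (toℕ p) a * g j)   ≈⟨ sym (*-assoc _ _ _) ⟩
      (f j * signed (toℕ p) a) * g j   ≈⟨ *-congʳ (*-comm _ _) ⟩
      (signed (toℕ p) a * f j) * g j   ≈⟨ *-assoc _ _ _ ⟩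
      signed (toℕ p) a * (f j * g j)   ∎

  det-additiveFirstColumn : ∀ s (A B C : Matrix (suc s)) →
    (∀ r → A r fzero ≈ B r fzero + C r fzero) →
    (∀ r c → A r (fsuc c) ≈ B r (fsuc c)) → (∀ r c → A r (fsuc c) ≈ C r (fsuc c)) →
    det R (suc s) A ≈ det R (suc s) B + det R (suc s) C
  det-additiveFirstColumn s A B C h₀ hB hC =
    trans (altSum-cong (λ j → A fzero j * det R s (minor A j)) _ (cofactor-additive s A B C h₀ hB hC))
          (altSum-+ (λ j → B fzero j * det R s (minor B j)) (λ j → C fzero j * det R s (minor C j)))
    where
    cofactor-additive : ∀ s (A B C : Matrix (suc s)) →
      (∀ r → A r fzero ≈ B r fzero + C r fzero) →
      (∀ r c → A r (fsuc c) ≈ B r (fsuc c)) → (∀ r c → A r (fsuc c) ≈ C r (fsuc c)) →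
      ∀ j → A fzero j * det R s (minor A j) ≈ B fzero j * det R s (minor B j) + C fzero j * det R s (minor C j)
    cofactor-additive s A B C h₀ hB hC fzero = trans (*-congʳ (h₀ fzero)) (trans (distribʳ _ _ _)
      (+-cong (*-congˡ (det-cong s (λ r c → hB (fsuc r) c))) (*-congˡ (det-cong s (λ r c → hC (fsuc r) c)))))
    cofactor-additive (suc s) A B C h₀ hB hC (fsuc j) =
      trans (*-congˡ (det-additiveFirstColumn s (minor A (fsuc j)) (minor B (fsuc j)) (minor C (fsuc j))
                       (λ r → h₀ (fsuc r)) (λ r c → hB (fsuc r) _) (λ r c → hC (fsuc r) _)))
            (trans (distribˡ _ _ _) (+-cong (*-congʳ (hB fzero j)) (*-congʳ (hC fzero j))))

  -- Expansion along a first column whose only nonzero entries are in row 0 and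
  -- row p+1: split that column in two (additivity) and expand each part.
  det-twoEntries : ∀ s (p : Fin s) (M : Matrix (suc s)) → (∀ r → r ≢ p → M (fsuc r) fzero ≈ 0#) →
    det R (suc s) M ≈ M fzero fzero * det R s (minor M fzero)
                    + signed (suc (toℕ p)) (M (fsuc p) fzero * det R s (λ r c → M (punchIn (fsuc p) r) (fsuc c)))
  det-twoEntries s p M below = begin
    det R (suc s) M                   ≈⟨ det-additiveFirstColumn s M top rest split (λ _ _ → refl) (λ _ _ → refl) ⟩
    det R (suc s) top + det R (suc s) rest
      ≈⟨ +-cong (det-topEntry s top (λ _ → refl)) (det-singleEntry s (fsuc p) rest restOnly) ⟩
    M fzero fzero * det R s (minor M fzero)
      + signed (suc (toℕ p)) (M (fsuc p) fzero * det R s (λ r c → M (punchIn (fsuc p) r) (fsuc c))) ∎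
    where
    top rest : Matrix (suc s)
    top r        (fsuc c) = M r (fsuc c)
    top fzero    fzero    = M fzero fzero
    top (fsuc r) fzero    = 0#
    rest r        (fsuc c) = M r (fsuc c)
    rest fzero    fzero    = 0#
    rest (fsuc r) fzero    = M (fsuc r) fzero
    split : ∀ r → M r fzero ≈ top r fzero + rest r fzero
    split fzero    = sym (+-identityʳ _)
    split (fsuc r) = sym (+-identityˡ _)
    restOnly : ∀ r → r ≢ fsuc p → rest r fzero ≈ 0#
    restOnly fzero    _    = refl
    restOnly (fsuc r) r≢p = below r (λ e → r≢p (≡.cong fsuc e))

  det-upperTriangular : ∀ s (M : Matrix s) d → (∀ r c → toℕ c < toℕ r → M r c ≈ 0#) → (∀ r → M r r ≈ d) →
                        det R s M ≈ pow R d s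
  det-upperTriangular zero    M d lower diag = refl
  det-upperTriangular (suc s) M d lower diag =
    trans (det-topEntry s M (λ r → lower (fsuc r) fzero (s≤s z≤n)))
          (*-cong (diag fzero) (det-upperTriangular s (minor M fzero) d
                                  (λ r c c<r → lower (fsuc r) (fsuc c) (s≤s c<r)) (λ r → diag (fsuc r))))

  module _ (x : Carrier) where

    entry : Bool → Bool → Carrier
    entry onDiagonal isArc = (if onDiagonal then x else 0#) - count R isArc

    entry-cong : ∀ {d d′ a a′} → d ≡ d′ → a ≡ a′ → entry d a ≈ entry d′ a′
    entry-cong e₁ e₂ = reflexive (≡.cong₂ entry e₁ e₂)

    H : ℕ → (s : ℕ) → Matrix s
    H K s r c = entry (toℕ r ≡ᵇ suc (toℕ c)) ((toℕ c ≡ᵇ toℕ r) ∨ ((toℕ r <ᵇ toℕ c) ∧ (toℕ c <ᵇ K)))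

    hessMinor : ℕ → (t : ℕ) → Matrix (suc t)
    hessMinor K t r c = H K (suc (suc t)) (punchIn (fsuc fzero) r) (fsuc c)

    hess-lowerRight : ∀ K t → det R (suc t) (minor (H K (suc (suc t))) fzero) ≈ det R (suc t) (H (K ∸ 1) (suc t))
    hess-lowerRight zero    t = refl
    hess-lowerRight (suc K) t = refl

    -- The first column of H_K(t+2) is (-1, x, 0, …, 0).
    hess-expand : ∀ K t → det R (suc (suc t)) (H K (suc (suc t)))
                          ≈ - det R (suc t) (H (K ∸ 1) (suc t)) + - (x * det R (suc t) (hessMinor K t))
    hess-expand K t = begin
      det R (suc (suc t)) (H K (suc (suc t)))
        ≈⟨ det-twoEntries (suc t) fzero (H K (suc (suc t))) below ⟩
      (0# - 1#) * det R (suc t) (minor (H K (suc (suc t))) fzero) + - ((x - 0#) * det R (suc t) (hessMinor K t))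
        ≈⟨ +-cong (trans (*-cong (0-y≈-y 1#) (hess-lowerRight K t)) (-1*x≈-x _)) (-‿cong (*-congʳ (y-0≈y x))) ⟩
      - det R (suc t) (H (K ∸ 1) (suc t)) + - (x * det R (suc t) (hessMinor K t)) ∎
      where
      below : ∀ r → r ≢ fzero → H K (suc (suc t)) (fsuc r) fzero ≈ 0#
      below fzero    r≢0 = ⊥-elim (r≢0 ≡.refl)
      below (fsuc r) _   = y-0≈y 0#

    hessMinor-short : ∀ K t → K ≤ 1 → ∀ c → hessMinor K t fzero c ≈ 0#
    hessMinor-short zero          t _ c = y-0≈y 0#
    hessMinor-short (suc zero)    t _ c = y-0≈y 0#
    hessMinor-short (suc (suc K)) t (s≤s ()) c

    hessMinor-long : ∀ K t r c → hessMinor (suc (suc K)) t r c ≈ H (suc K) (suc t) r c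
    hessMinor-long K t fzero    fzero    = refl
    hessMinor-long K t fzero    (fsuc c) = refl
    hessMinor-long K t (fsuc r) c        = refl

    hess-step-short : ∀ K t → K ≤ 1 →
      det R (suc (suc t)) (H K (suc (suc t))) ≈ - det R (suc t) (H (K ∸ 1) (suc t))
    hess-step-short K t K≤1 = begin
      det R (suc (suc t)) (H K (suc (suc t)))    ≈⟨ hess-expand K t ⟩
      - D + - (x * det R (suc t) (hessMinor K t))
        ≈⟨ +-congˡ (-‿cong (trans (*-congˡ (det-zeroTopRow t (hessMinor K t) (hessMinor-short K t K≤1))) (zeroʳ x))) ⟩
      - D + - 0#                                 ≈⟨ y-0≈y (- D) ⟩
      - D                                        ∎
      where D = det R (suc t) (H (K ∸ 1) (suc t))

    hess-step-long : ∀ K t →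
      det R (suc (suc t)) (H (suc (suc K)) (suc (suc t))) ≈ - ((x + 1#) * det R (suc t) (H (suc K) (suc t)))
    hess-step-long K t = begin
      det R (suc (suc t)) (H (suc (suc K)) (suc (suc t)))  ≈⟨ hess-expand (suc (suc K)) t ⟩
      - D + - (x * det R (suc t) (hessMinor (suc (suc K)) t))
        ≈⟨ +-congˡ (-‿cong (*-congˡ (det-cong (suc t) (hessMinor-long K t)))) ⟩
      - D + - (x * D)        ≈⟨ -‿+-comm D (x * D) ⟩
      - (D + x * D)          ≈⟨ -‿cong (+-comm D (x * D)) ⟩
      - (x * D + D)          ≈⟨ -‿cong (+-congˡ (sym (*-identityˡ D))) ⟩
      - (x * D + 1# * D)     ≈⟨ -‿cong (sym (distribʳ D x 1#)) ⟩
      - ((x + 1#) * D)       ∎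
      where D = det R (suc t) (H (suc K) (suc t))

    hess-1×1 : ∀ K → det R 1 (H K 1) ≈ - 1#
    hess-1×1 K = trans (y-0≈y _) (trans (*-identityʳ _) (0-y≈-y 1#))

    det-hessenberg : ∀ t K → K ≤ suc t → det R (suc t) (H K (suc t)) ≈ signed (suc t) (pow R (x + 1#) (K ∸ 1))
    det-hessenberg zero    zero          _ = hess-1×1 0
    det-hessenberg zero    (suc zero)    _ = hess-1×1 1
    det-hessenberg zero    (suc (suc K)) (s≤s ())
    det-hessenberg (suc t) zero          _ = trans (hess-step-short 0 t z≤n) (-‿cong (det-hessenberg t 0 z≤n))
    det-hessenberg (suc t) (suc zero)    _ = trans (hess-step-short 1 t ≤-refl) (-‿cong (det-hessenberg t 0 z≤n))
    det-hessenberg (suc t) (suc (suc K)) (s≤s K+1≤t+1) = begin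
      det R (suc (suc t)) (H (suc (suc K)) (suc (suc t)))  ≈⟨ hess-step-long K t ⟩
      - ((x + 1#) * det R (suc t) (H (suc K) (suc t)))     ≈⟨ -‿cong (*-congˡ (det-hessenberg t (suc K) K+1≤t+1)) ⟩
      - ((x + 1#) * signed (suc t) (pow R (x + 1#) K))     ≈⟨ -‿cong (signed-*ʳ (suc t) (x + 1#) _) ⟩
      signed (suc (suc t)) (pow R (x + 1#) (suc K))        ∎

    module CharMatrix (k K : ℕ) where
      M : Matrix (suc (suc k))
      M = charMat R (suc (suc k)) (suc K) x

      -- row `fsuc last` belongs to vertex n
      last : Fin (suc k)
      last = fromℕ k

      M-topLeft : M fzero fzero ≈ x
      M-topLeft = y-0≈y x

      M-firstColumn : ∀ r → r ≢ last → M (fsuc r) fzero ≈ 0#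
      M-firstColumn r r≢last =
        trans (entry-cong ≡.refl (≡.trans (arc-into-first (suc (suc k)) (suc K) (suc (toℕ r)))
                                          (⌊⌋-false (suc (suc (toℕ r)) ≟ suc (suc k)) r+2≢n)))
              (y-0≈y 0#)
        where
        r+2≢n : suc (suc (toℕ r)) ≢ suc (suc k)
        r+2≢n e = r≢last (toℕ-injective (≡.trans (ℕ.suc-injective (ℕ.suc-injective e)) (≡.sym (toℕ-fromℕ k))))

      M-last : M (fsuc last) fzero ≈ - 1#
      M-last =
        trans (entry-cong ≡.refl (≡.trans (arc-into-first (suc (suc k)) (suc K) (suc (toℕ last)))
                                          (⌊⌋-true (suc (suc (toℕ last)) ≟ suc (suc k))
                                                   (≡.cong (λ i → suc (suc i)) (toℕ-fromℕ k)))))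
              (0-y≈-y 1#)

      M-belowDiagonal : ∀ r c → toℕ c < toℕ r → M (fsuc r) (fsuc c) ≈ 0#
      M-belowDiagonal r c c<r =
        trans (entry-cong (⌊⌋-false (fsuc r ≟ᶠ fsuc c) (λ e → <-irrefl (≡.cong toℕ (≡.sym (suc-injective e))) c<r))
                          (arc-backward (suc (suc k)) (suc K) (toℕ r) (toℕ c) (<⇒≤ c<r)))
              (y-0≈y 0#)

      M-diagonal : ∀ r → M (fsuc r) (fsuc r) ≈ x
      M-diagonal r =
        trans (entry-cong (⌊⌋-true (fsuc r ≟ᶠ fsuc r) ≡.refl) (arc-backward (suc (suc k)) (suc K) (toℕ r) (toℕ r) ≤-refl))
              (y-0≈y x)

      M-minorLast : ∀ r c → M (punchIn (fsuc last) r) (fsuc c) ≈ H K (suc k) r c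
      M-minorLast r c =
        entry-cong (≡.trans (⌊≟ᶠ⌋-toℕ (punchIn (fsuc last) r) (fsuc c)) (≡.cong (_≡ᵇ suc (toℕ c)) row))
                   (≡.trans (≡.cong (λ i → arc (suc (suc k)) (suc K) (suc i) (suc (suc (toℕ c)))) row)
                            (arc-chord (suc (suc k)) K (toℕ r) (toℕ c) (s≤s (toℕ<n r))))
        where
        row : toℕ (punchIn (fsuc last) r) ≡ toℕ r
        row = toℕ-punchIn-last (suc k) r

    charPoly-DC : ∀ k K → K ≤ suc k →
                  charPolyDC R (suc (suc k)) (suc K) x ≈ pow R x (suc (suc k)) - pow R (x + 1#) (K ∸ 1)
    charPoly-DC k K K≤k+1 = begin
      det R (suc (suc k)) M
        ≈⟨ det-twoEntries (suc k) last M M-firstColumn ⟩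
      M fzero fzero * det R (suc k) (minor M fzero)
        + signed (suc (toℕ last)) (M (fsuc last) fzero * det R (suc k) (λ r c → M (punchIn (fsuc last) r) (fsuc c)))
        ≈⟨ +-cong (*-cong M-topLeft (det-upperTriangular (suc k) (minor M fzero) x M-belowDiagonal M-diagonal))
                  (signed-cong (suc (toℕ last))
                     (*-cong M-last (trans (det-cong (suc k) M-minorLast) (det-hessenberg k K K≤k+1)))) ⟩
      x * pow R x (suc k) + signed (suc (toℕ last)) (- 1# * signed (suc k) Y)
        ≈⟨ +-congˡ (reflexive (≡.cong (λ i → signed (suc i) (- 1# * signed (suc k) Y)) (toℕ-fromℕ k))) ⟩
      x * pow R x (suc k) + signed (suc k) (- 1# * signed (suc k) Y)
        ≈⟨ +-congˡ (trans (signed-cong (suc k) (-1*x≈-x _)) (signed-neg (suc k) _)) ⟩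
      x * pow R x (suc k) - signed (suc k) (signed (suc k) Y)
        ≈⟨ +-congˡ (-‿cong (signed-involutive (suc k) Y)) ⟩
      x * pow R x (suc k) - Y ∎
      where
      open CharMatrix k K
      Y = pow R (x + 1#) (K ∸ 1)

mainTheorem6 : ∀ {c ℓ : Level} (R : CommutativeRing c ℓ) (n m : ℕ) →
    4 ≤ n → 3 ≤ m → m ≤ n ∸ 1 →
    (x : CommutativeRing.Carrier R) →
    CommutativeRing._≈_ R (charPolyDC R n m x)
      (CommutativeRing._-_ R (pow R x n)
        (pow R (CommutativeRing._+_ R x (CommutativeRing.1# R)) (m ∸ 2)))
mainTheorem6 R zero          m       ()       _  _     _
mainTheorem6 R (suc zero)    m       (s≤s ()) _  _     _
mainTheorem6 R (suc (suc k)) zero    _        () _     _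
mainTheorem6 R (suc (suc k)) (suc K) _        _  m≤n-1 x = charPoly-DC R x k K (≤-trans (n≤1+n K) m≤n-1)
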